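{- Let $G=(A\cup B,E)$ be an instance of the super-stable matching problem with incomplete lists and ties, let $(m,w)\in E$, and let $G'$ be the reduced graph of $G$ with respect to $(m,w)$ (defined in the context). If $M$ is a super-stable matching of $G$ containing $(m,w)$, then $M\setminus\{(m,w)\}$ is a super-stable matching in $G'$.
   Context: An instance is a bipartite graph $G=(A\cup B,E)$ ($A$ = men, $B$ = women) in which each vertex $x$ ranks its neighbours in a linearly ordered list of ties (a weak order); $y_1\succ_x y_2$ means $x$ strictly prefers $y_1$ to $y_2$, $y_1=_x y_2$ means indifference, and $y_1\succeq_x y_2$ (equivalently $y_2\preceq_x y_1$) means $y_1\succ_x y_2$ or $y_1=_x y_2$. For a matching $M$, $M(x)$ is the partner of a matched vertex $x$. An edge $(x,y)\in E\setminus M$ blocks $M$ if ($x$ is unmatched in $M$ or $y\succeq_x M(x)$) and ($y$ is unmatched in $M$ or $x\succeq_y M(y)$); $M$ is super-stable if no edge of the graph blocks it. The reduced graph $G'$ with respect to $(m,w)$ is obtained from $G$ by: deleting the vertices $m$ and $w$ together with all edges incident to them; then, for every $m'$ with $(m',w)\in E$ and $m\preceq_w m'$, deleting every edge $(m',w')$ with $w\succeq_{m'} w'$; and, for every $w'$ with $(m,w')\in E$ and $w\preceq_m w'$, deleting every edge $(m',w')$ with $m\succeq_{w'} m'$. -}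

module Defs where

open import Data.Nat using (ℕ; _≤_)
open import Data.Fin using (Fin)
open import Data.Product using (Σ; ∃; _×_)
open import Data.Sum using (_⊎_)
open import Data.Empty using (⊥)
open import Relation.Nullary using (¬_)
open import Relation.Binary.PropositionalEquality using (_≡_; _≢_)

-- An instance: men Fin nA, women Fin nB, an edge relation E, and for each
-- vertex a weak order on (its neighbours), encoded by ranks:
-- y₁ ≻_x y₂ iff rank x y₁ < rank x y₂, y₁ =_x y₂ iff ranks equal
-- (smaller rank = more preferred). Ranks of non-neighbours are irrelevant.
record Instance : Set₁ where
  field
    nA nB : ℕ
    E     : Fin nA → Fin nB → Set
    rankM : Fin nA → Fin nB → ℕ
    rankW : Fin nB → Fin nA → ℕ

module _ (G : Instance) where
  open Instance G

  _⪰M[_]_ : Fin nB → Fin nA → Fin nB → Set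
  w₁ ⪰M[ m ] w₂ = rankM m w₁ ≤ rankM m w₂

  _⪰W[_]_ : Fin nA → Fin nB → Fin nA → Set
  m₁ ⪰W[ w ] m₂ = rankW w m₁ ≤ rankW w m₂

  record IsMatching (M : Fin nA → Fin nB → Set) : Set where
    field
      sub    : ∀ a b → M a b → E a b
      uniqA  : ∀ a b b' → M a b → M a b' → b ≡ b'
      uniqB  : ∀ a a' b → M a b → M a' b → a ≡ a'

  UnmatchedA : (Fin nA → Fin nB → Set) → Fin nA → Set
  UnmatchedA M a = ∀ b → ¬ M a b

  UnmatchedB : (Fin nA → Fin nB → Set) → Fin nB → Set
  UnmatchedB M b = ∀ a → ¬ M a b

  Blocks : (Fin nA → Fin nB → Set) → Fin nA → Fin nB → Set
  Blocks M a b =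
    E a b × ¬ M a b
    × (UnmatchedA M a ⊎ Σ (Fin nB) (λ b' → M a b' × b ⪰M[ a ] b'))
    × (UnmatchedB M b ⊎ Σ (Fin nA) (λ a' → M a' b × a ⪰W[ b ] a'))

  SuperStable : (Fin nA → Fin nB → Set) → Set
  SuperStable M = IsMatching M × (∀ a b → ¬ Blocks M a b)

-- Deleting the vertices m and w is modelled by
-- deleting all edges incident to them (m, w become isolated vertices).
reducedE : (G : Instance) → Fin (Instance.nA G) → Fin (Instance.nB G)
         → Fin (Instance.nA G) → Fin (Instance.nB G) → Set
reducedE G m w m' w' =
  E m' w' × m' ≢ m × w' ≢ w
  -- for every m' with (m',w) ∈ E and m ⪯_w m', delete (m',w') with w ⪰_{m'} w'
  × ¬ (E m' w × (_⪰W[_]_ G m' w m) × (_⪰M[_]_ G w m' w'))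
  -- for every w' with (m,w') ∈ E and w ⪯_m w', delete (m',w') with m ⪰_{w'} m'
  × ¬ (E m w' × (_⪰M[_]_ G w' m w) × (_⪰W[_]_ G m w' m'))
  where open Instance G

reduced : (G : Instance) → Fin (Instance.nA G) → Fin (Instance.nB G) → Instance
reduced G m w = record
  { nA = nA ; nB = nB ; E = reducedE G m w ; rankM = rankM ; rankW = rankW }
  where open Instance G

removeEdge : {nA nB : ℕ} → (Fin nA → Fin nB → Set) → Fin nA → Fin nB
           → Fin nA → Fin nB → Set
removeEdge M m w a b = M a b × ¬ (a ≡ m × b ≡ w)

-- An edge (m′, w′) of M ∖ {(m, w)} avoids m and w because M is a matching, and the
-- reduction cannot have deleted it: otherwise (m′, w) or (m, w′) would be a pair in
-- which each side weakly prefers the other to its M-partner, i.e. a blocking pair of M.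
-- Conversely, G′ has fewer edges than G, the same preferences, and the vertices of G′
-- other than m and w have the same partners in M ∖ {(m, w)} as in M, so a blocking
-- edge of M ∖ {(m, w)} in G′ would block M in G.
module Submission where

open import Defs
open import Data.Fin using (Fin)
open import Data.Product using (_,_; proj₁; proj₂)
open import Data.Sum using (inj₂) renaming (map to ⊎-map)
open import Function using (_∘_)
open import Relation.Nullary using (¬_)
open import Relation.Binary.PropositionalEquality using (_≢_; refl; sym)

module _ (G : Instance) where
  open Instance G

  module _ {M : Fin nA → Fin nB → Set} (isM : IsMatching G M) where
    open IsMatching isM

    mutually-weakly-preferred⇒blocks :
      ∀ {a a′ b b′} → M a b → M a′ b′ → a ≢ a′ → E a b′
      → _⪰M[_]_ G b′ a b → _⪰W[_]_ G a b′ a′ → Blocks G M a b′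
    mutually-weakly-preferred⇒blocks Mab Ma′b′ a≢a′ Eab′ b′⪰b a⪰a′ =
      Eab′ , (λ Mab′ → a≢a′ (uniqB _ _ _ Mab′ Ma′b′)) ,
      inj₂ (_ , Mab , b′⪰b) , inj₂ (_ , Ma′b′ , a⪰a′)

    module _ {m w} (Mmw : M m w) where

      removeEdge-avoids-m : ∀ {a b} → removeEdge M m w a b → a ≢ m
      removeEdge-avoids-m (Mab , ≢mw) refl = ≢mw (refl , uniqA _ _ _ Mab Mmw)

      removeEdge-avoids-w : ∀ {a b} → removeEdge M m w a b → b ≢ w
      removeEdge-avoids-w (Mab , ≢mw) refl = ≢mw (uniqB _ _ _ Mab Mmw , refl)

      removeEdge⇒reducedE : (∀ a b → ¬ Blocks G M a b) → ∀ {a b}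
                          → removeEdge M m w a b → reducedE G m w a b
      removeEdge⇒reducedE stable r@(Mab , _) =
        sub _ _ Mab , a≢m , removeEdge-avoids-w r ,
        (λ (Eaw , a⪰m , w⪰b) →
          stable _ _ (mutually-weakly-preferred⇒blocks Mab Mmw a≢m Eaw w⪰b a⪰m)) ,
        (λ (Emb , b⪰w , m⪰a) →
          stable _ _ (mutually-weakly-preferred⇒blocks Mmw Mab (a≢m ∘ sym) Emb b⪰w m⪰a))
        where a≢m = removeEdge-avoids-m r

  removeEdge-isMatching : ∀ {M m w} → (∀ a b → removeEdge M m w a b → reducedE G m w a b)
                        → IsMatching G M → IsMatching (reduced G m w) (removeEdge M m w)
  removeEdge-isMatching sub′ isM = record
    { sub   = sub′
    ; uniqA = λ a b b′ r r′ → uniqA a b b′ (proj₁ r) (proj₁ r′)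
    ; uniqB = λ a a′ b r r′ → uniqB a a′ b (proj₁ r) (proj₁ r′)
    }
    where open IsMatching isM

  reduced-blocks⇒blocks : ∀ {M m w a b}
    → Blocks (reduced G m w) (removeEdge M m w) a b → Blocks G M a b
  reduced-blocks⇒blocks ((Eab , a≢m , b≢w , _) , ¬M′ab , a-side , b-side) =
    Eab , (λ Mab → ¬M′ab (Mab , a≢m ∘ proj₁)) ,
    ⊎-map (λ u b′ Mab′ → u b′ (Mab′ , a≢m ∘ proj₁)) (λ (b′ , r , p) → b′ , proj₁ r , p) a-side ,
    ⊎-map (λ u a′ Ma′b → u a′ (Ma′b , b≢w ∘ proj₂)) (λ (a′ , r , p) → a′ , proj₁ r , p) b-side

mainTheorem2 : (G : Instance) (m : Fin (Instance.nA G)) (w : Fin (Instance.nB G))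
    → Instance.E G m w
    → (M : Fin (Instance.nA G) → Fin (Instance.nB G) → Set)
    → SuperStable G M → M m w
    → SuperStable (reduced G m w) (removeEdge M m w)
-- The hypothesis (m, w) ∈ E is implied by M m w.
mainTheorem2 G m w _ M (isM , stable) Mmw =
  removeEdge-isMatching G (λ _ _ → removeEdge⇒reducedE G isM Mmw stable) isM ,
  λ a b → stable a b ∘ reduced-blocks⇒blocks G
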